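{- Let $G$ be a finite group of order $2v$ with a normal subgroup $N = \{1,z\}$ of order $2$, and let $S \subseteq G$ be a $(2v,2k+1,2\beta)$ sum set which is type 2 with respect to $N$. Then $P = \{sN : s \in S \setminus N\}$ is a $(v,k,\beta-1,\beta)$ partial sum set in $G/N$.
   Context: For a finite group $X$ of order $w$, a subset $T \subseteq X$ with $|T| = k$ and $a \in X$, the number of ways to write $a$ as a product in $T$ is the number of ordered pairs $(x,y)\in T\times T$ with $xy=a$. $T$ is a $(w,k,\lambda,\mu)$ partial sum set if every nonidentity element of $T$ is a product in $T$ in exactly $\lambda$ ways and every nonidentity element of $X\setminus T$ is a product in $T$ in exactly $\mu$ ways; if $\lambda=\mu$, $T$ is a $(w,k,\mu)$ sum set. A sum set $S$ is type 2 with respect to $N$ if $|S\cap N| = 1$ and $S$ meets each other coset of $N$ in $0$ or $2$ elements. -}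

module Defs where

open import Level using (0ℓ)
open import Algebra.Bundles using (Group)
open import Algebra.Structures using (IsGroup; IsMonoid; IsSemigroup; IsMagma)
import Algebra.Properties.Group as GroupProps
open import Data.Bool using (Bool; true; false; _∧_; _∨_; not; if_then_else_)
open import Data.Nat using (ℕ; zero; suc; _+_)
open import Data.Integer using (ℤ; +_)
open import Data.List using (List; []; _∷_; length; map)
open import Data.Nat.ListAction using (sum)
open import Data.Bool.ListAction using (any)
open import Data.Product using (_×_; _,_)
open import Data.Sum using (_⊎_; inj₁; inj₂)
open import Data.Empty using (⊥; ⊥-elim)
open import Relation.Nullary using (¬_; yes; no)
open import Relation.Nullary.Decidable using (⌊_⌋)
open import Relation.Binary.Definitions using (Decidable)
open import Relation.Binary.Structures using (IsEquivalence)
open import Relation.Binary.PropositionalEquality using (_≡_)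
import Relation.Binary.PropositionalEquality as Eq
import Relation.Binary.Reasoning.Setoid as SetoidReasoning

countB : {A : Set} → (A → Bool) → List A → ℕ
countB p [] = 0
countB p (x ∷ xs) = if p x then suc (countB p xs) else countB p xs

-- A finite group: a group (with setoid equality ≈) whose equality is
-- decidable, together with a list `elems` listing every element exactly
-- once (up to ≈).
record FinGroup : Set₁ where
  field
    group : Group 0ℓ 0ℓ
  open Group group public
  field
    _≟_      : Decidable _≈_
    elems    : List Carrier
    complete : ∀ x → countB (λ y → ⌊ x ≟ y ⌋) elems ≡ 1

module _ (X : FinGroup) where
  open FinGroup X

  order : ℕ
  order = length elems

  Subset : Set
  Subset = Carrier → Bool

  size : Subset → ℕ
  size T = countB T elems

  reps : Subset → Carrier → ℕ
  reps T a = sum (map (λ x → countB (λ y → T x ∧ T y ∧ ⌊ (x ∙ y) ≟ a ⌋) elems) elems)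

  -- (w , k , λ , μ) partial sum set (λ, μ taken as integers so that
  -- parameters like β - 1 are read literally, without truncation)
  IsPartialSumSet : ℕ → ℕ → ℤ → ℤ → Subset → Set
  IsPartialSumSet w k lam mu T =
    order ≡ w × size T ≡ k
    × (∀ a → ¬ (a ≈ ε) → T a ≡ true  → + reps T a ≡ lam)
    × (∀ a → ¬ (a ≈ ε) → T a ≡ false → + reps T a ≡ mu)

  IsSumSet : ℕ → ℕ → ℤ → Subset → Set
  IsSumSet w k mu T = IsPartialSumSet w k mu mu T

  Respects : Subset → Set
  Respects T = ∀ {x y} → x ≈ y → T x ≡ T y

  -- S is type 2 with respect to the subgroup N (given by membership):
  -- |S ∩ N| = 1 and every coset gN ≠ N meets S in 0 or 2 elements.
  -- (x ∈ gN  iff  g⁻¹ ∙ x ∈ N)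
  IsType2 : (N : Subset) → Subset → Set
  IsType2 N S =
    countB (λ x → S x ∧ N x) elems ≡ 1
    × (∀ g → N g ≡ false →
         countB (λ x → S x ∧ N ((g ⁻¹) ∙ x)) elems ≡ 0
         ⊎ countB (λ x → S x ∧ N ((g ⁻¹) ∙ x)) elems ≡ 2)

  pairN : Carrier → Subset
  pairN z x = ⌊ x ≟ ε ⌋ ∨ ⌊ x ≟ z ⌋

  record NormalOrder2 (z : Carrier) : Set where
    field
      z≉ε    : ¬ (z ≈ ε)
      z∙z≈ε  : (z ∙ z) ≈ ε
      normal : ∀ g n → pairN z n ≡ true → pairN z ((g ∙ n) ∙ (g ⁻¹)) ≡ true

-- The quotient group G/N for N = {ε , z}: same carrier, with
-- x ~ y  iff  y ∈ xN  (i.e. y ≈ x or y ≈ x ∙ z).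
module Quotient (X : FinGroup) (z : FinGroup.Carrier X)
                (hN : NormalOrder2 X z) where
  open FinGroup X
  open NormalOrder2 hN
  open GroupProps group using (inverseʳ-unique; ⁻¹-anti-homo-∙; x∙y⁻¹≈ε⇒x≈y)
  open SetoidReasoning setoid

  zInN : pairN X z z ≡ true
  zInN with z ≟ ε | z ≟ z
  ... | yes _ | _ = Eq.refl
  ... | no _ | yes _ = Eq.refl
  ... | no _ | no ¬p = ⊥-elim (¬p refl)

  fromPairN : ∀ x → pairN X z x ≡ true → x ≈ ε ⊎ x ≈ z
  fromPairN x h with x ≟ ε | x ≟ z
  ... | yes p | _ = inj₁ p
  ... | no _ | yes q = inj₂ q
  ... | no _ | no _ with h
  ... | ()

  central : ∀ g → (g ∙ z) ≈ (z ∙ g)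
  central g with fromPairN _ (normal g z zInN)
  ... | inj₁ p = ⊥-elim (z≉ε (begin
          z                     ≈⟨ sym (identityˡ z) ⟩
          ε ∙ z                 ≈⟨ ∙-congʳ (sym (inverseˡ g)) ⟩
          (g ⁻¹ ∙ g) ∙ z        ≈⟨ assoc _ _ _ ⟩
          g ⁻¹ ∙ (g ∙ z)        ≈⟨ ∙-congˡ (x∙y⁻¹≈ε⇒x≈y (g ∙ z) g p) ⟩
          g ⁻¹ ∙ g              ≈⟨ inverseˡ g ⟩
          ε                     ∎))
  ... | inj₂ q = begin
          g ∙ z                     ≈⟨ sym (identityʳ _) ⟩
          (g ∙ z) ∙ ε               ≈⟨ ∙-congˡ (sym (inverseˡ g)) ⟩
          (g ∙ z) ∙ (g ⁻¹ ∙ g)      ≈⟨ sym (assoc _ _ _) ⟩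
          ((g ∙ z) ∙ g ⁻¹) ∙ g      ≈⟨ ∙-congʳ q ⟩
          z ∙ g                     ∎

  infix 4 _∼_
  _∼_ : Carrier → Carrier → Set
  x ∼ y = y ≈ x ⊎ y ≈ x ∙ z

  xzz : ∀ x → (x ∙ z) ∙ z ≈ x
  xzz x = begin
    (x ∙ z) ∙ z  ≈⟨ assoc _ _ _ ⟩
    x ∙ (z ∙ z)  ≈⟨ ∙-congˡ z∙z≈ε ⟩
    x ∙ ε        ≈⟨ identityʳ x ⟩
    x            ∎

  ∼-sym : ∀ {x y} → x ∼ y → y ∼ x
  ∼-sym (inj₁ p) = inj₁ (sym p)
  ∼-sym {x} {y} (inj₂ p) = inj₂ (begin
    x ≈⟨ sym (xzz x) ⟩ (x ∙ z) ∙ z ≈⟨ ∙-congʳ (sym p) ⟩ y ∙ z ∎)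

  ∼-trans : ∀ {x y w} → x ∼ y → y ∼ w → x ∼ w
  ∼-trans (inj₁ p) (inj₁ q) = inj₁ (trans q p)
  ∼-trans (inj₁ p) (inj₂ q) = inj₂ (trans q (∙-congʳ p))
  ∼-trans (inj₂ p) (inj₁ q) = inj₂ (trans q p)
  ∼-trans {x} (inj₂ p) (inj₂ q) = inj₁ (trans q (trans (∙-congʳ p) (xzz x)))

  ∼-isEquivalence : IsEquivalence _∼_
  ∼-isEquivalence = record { refl = inj₁ refl ; sym = ∼-sym ; trans = ∼-trans }

  zmid : ∀ x y → (x ∙ z) ∙ y ≈ (x ∙ y) ∙ z
  zmid x y = begin
    (x ∙ z) ∙ y ≈⟨ assoc _ _ _ ⟩
    x ∙ (z ∙ y) ≈⟨ ∙-congˡ (sym (central y)) ⟩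
    x ∙ (y ∙ z) ≈⟨ sym (assoc _ _ _) ⟩
    (x ∙ y) ∙ z ∎

  ∼-∙-cong : ∀ {x x′ y y′} → x ∼ x′ → y ∼ y′ → (x ∙ y) ∼ (x′ ∙ y′)
  ∼-∙-cong (inj₁ p) (inj₁ q) = inj₁ (∙-cong p q)
  ∼-∙-cong (inj₁ p) (inj₂ q) = inj₂ (trans (∙-cong p q) (sym (assoc _ _ _)))
  ∼-∙-cong (inj₂ p) (inj₁ q) = inj₂ (trans (∙-cong p q) (zmid _ _))
  ∼-∙-cong {x} {x′} {y} {y′} (inj₂ p) (inj₂ q) = inj₁ (begin
    x′ ∙ y′             ≈⟨ ∙-cong p q ⟩
    (x ∙ z) ∙ (y ∙ z)   ≈⟨ sym (assoc _ _ _) ⟩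
    ((x ∙ z) ∙ y) ∙ z   ≈⟨ ∙-congʳ (zmid x y) ⟩
    ((x ∙ y) ∙ z) ∙ z   ≈⟨ xzz _ ⟩
    x ∙ y               ∎)

  z⁻¹≈z : z ⁻¹ ≈ z
  z⁻¹≈z = sym (inverseʳ-unique z z z∙z≈ε)

  ∼-⁻¹-cong : ∀ {x y} → x ∼ y → (x ⁻¹) ∼ (y ⁻¹)
  ∼-⁻¹-cong (inj₁ p) = inj₁ (⁻¹-cong p)
  ∼-⁻¹-cong {x} {y} (inj₂ p) = inj₂ (begin
    y ⁻¹             ≈⟨ ⁻¹-cong p ⟩
    (x ∙ z) ⁻¹       ≈⟨ ⁻¹-anti-homo-∙ x z ⟩
    z ⁻¹ ∙ x ⁻¹      ≈⟨ ∙-congʳ z⁻¹≈z ⟩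
    z ∙ x ⁻¹         ≈⟨ sym (central _) ⟩
    x ⁻¹ ∙ z         ∎)

  quotientGroup : Group 0ℓ 0ℓ
  quotientGroup = record
    { Carrier = Carrier
    ; _≈_ = _∼_
    ; _∙_ = _∙_
    ; ε = ε
    ; _⁻¹ = _⁻¹
    ; isGroup = record
      { isMonoid = record
        { isSemigroup = record
          { isMagma = record
            { isEquivalence = ∼-isEquivalence
            ; ∙-cong = ∼-∙-cong }
          ; assoc = λ x y w → inj₁ (sym (assoc x y w)) }
        ; identity = (λ x → inj₁ (sym (identityˡ x))) , (λ x → inj₁ (sym (identityʳ x))) }
      ; inverse = (λ x → inj₁ (sym (inverseˡ x))) , (λ x → inj₁ (sym (inverseʳ x)))
      ; ⁻¹-cong = ∼-⁻¹-cong }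
    }

  _∼?_ : Decidable _∼_
  x ∼? y with y ≟ x | y ≟ (x ∙ z)
  ... | yes p | _ = yes (inj₁ p)
  ... | no _ | yes q = yes (inj₂ q)
  ... | no ¬p | no ¬q = no λ { (inj₁ p) → ¬p p ; (inj₂ q) → ¬q q }

  -- G/N as a finite group, given a list R containing exactly one
  -- representative of each coset of N
  quotientFin : (R : List Carrier) → (∀ x → countB (λ y → ⌊ x ∼? y ⌋) R ≡ 1) → FinGroup
  quotientFin R hR = record
    { group = quotientGroup ; _≟_ = _∼?_ ; elems = R ; complete = hR }

  cosetImage : Subset X → Carrier → Bool
  cosetImage S c = any (λ s → S s ∧ not (pairN X z s) ∧ ⌊ c ∼? s ⌋) elems

-- Since S has type 2, S ∖ N meets each coset of N in 0 or 2 elements, so it is the union of the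
-- cosets in P and |S ∖ N| = 2|P|.  Write S = (S ∖ N) ∪ {s₀} with s₀ ∈ N.  For aN ≠ N, the
-- representations a = x y with x, y ∈ S are: those with x, y ∈ S ∖ N, which lie two over each
-- representation aN = (xN)(yN) in P; those with x = s₀ or y = s₀, one each exactly when a ∈ S ∖ N;
-- and none with x, y ∈ N.  Hence 2β = 2 (#reps of aN in P + [aN ∈ P]).
module Submission where

open import Defs
open import Algebra.Bundles using (Group)
import Algebra.Properties.Group as GroupProperties
open import Data.Bool using (Bool; true; false; _∧_; not)
open import Data.Bool.Properties
  using (∧-assoc; ∧-comm; ∧-zeroʳ; ∧-conicalˡ; ∧-conicalʳ; ¬-not; not-injective)
open import Data.Bool.ListAction using (any)
open import Data.Integer using (+_; _-_)
import Data.Integer.Properties as ℤ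
open import Data.List using (List; []; _∷_; length; map)
open import Data.Nat using (ℕ; suc; _+_; _*_)
open import Data.Nat.ListAction using (sum)
open import Data.Nat.Properties
  using (+-assoc; +-comm; +-commutativeSemigroup; +-identityʳ; *-zeroʳ; *-identityʳ; *-distribˡ-+;
         +-cancelʳ-≡; *-cancelˡ-≡)
open import Data.Product using (Σ; _,_; proj₁; proj₂)
open import Data.Sum using (inj₁; inj₂)
open import Function using (_∘_)
open import Relation.Nullary using (¬_; Dec; yes; no; contradiction)
open import Relation.Nullary.Decidable using (⌊_⌋)
open import Relation.Binary.PropositionalEquality
  using (_≡_; refl; sym; trans; cong; cong₂; module ≡-Reasoning)
import Relation.Binary.Reasoning.Setoid as SetoidReasoning
open import Algebra.Properties.CommutativeSemigroup +-commutativeSemigroup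
  using () renaming (interchange to +-interchange)

toℕ : Bool → ℕ
toℕ true  = 1
toℕ false = 0

toℕ-double : ∀ b → toℕ b + toℕ b ≡ 2 * toℕ b
toℕ-double true  = refl
toℕ-double false = refl

toℕ-partition : ∀ s n → toℕ s ≡ toℕ (s ∧ not n) + toℕ (s ∧ n)
toℕ-partition true  true  = refl
toℕ-partition true  false = refl
toℕ-partition false _     = refl

toℕ-partitionˡ : ∀ s n b → toℕ (s ∧ b) ≡ toℕ ((s ∧ not n) ∧ b) + toℕ ((s ∧ n) ∧ b)
toℕ-partitionˡ true  true  b = refl
toℕ-partitionˡ true  false b = sym (+-identityʳ (toℕ b))
toℕ-partitionˡ false _     _ = refl

toℕ-partitionʳ : ∀ b s n → toℕ (b ∧ s) ≡ toℕ (b ∧ (s ∧ not n)) + toℕ (b ∧ (s ∧ n))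
toℕ-partitionʳ true  s n = toℕ-partition s n
toℕ-partitionʳ false _ _ = refl

true-ext : ∀ {b c : Bool} → (b ≡ true → c ≡ true) → (c ≡ true → b ≡ true) → b ≡ c
true-ext {true}  {true}  _   _   = refl
true-ext {true}  {false} b⇒c _   = sym (b⇒c refl)
true-ext {false} {true}  _   c⇒b = c⇒b refl
true-ext {false} {false} _   _   = refl

true⇒witness : ∀ {P : Set} (p? : Dec P) → ⌊ p? ⌋ ≡ true → P
true⇒witness (yes p) _ = p

witness⇒true : ∀ {P : Set} (p? : Dec P) → P → ⌊ p? ⌋ ≡ true
witness⇒true (yes _) _ = refl
witness⇒true (no ¬p) p = contradiction p ¬p

∧-congˡ-guarded : ∀ {b b′ c : Bool} → (c ≡ true → b ≡ b′) → b ∧ c ≡ b′ ∧ c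
∧-congˡ-guarded {b} {b′} {true}  b≡b′ = cong (_∧ true) (b≡b′ refl)
∧-congˡ-guarded {b} {b′} {false} _    = trans (∧-zeroʳ b) (sym (∧-zeroʳ b′))

∧-congʳ-guarded : ∀ {b c c′ : Bool} → (b ≡ true → c ≡ c′) → b ∧ c ≡ b ∧ c′
∧-congʳ-guarded {true}  c≡c′ = c≡c′ refl
∧-congʳ-guarded {false} _    = refl

module _ {A : Set} where

  countB-∷ : ∀ (p : A → Bool) x xs → countB p (x ∷ xs) ≡ toℕ (p x) + countB p xs
  countB-∷ p x xs with p x
  ... | true  = refl
  ... | false = refl

  countB≡sum : ∀ (p : A → Bool) xs → countB p xs ≡ sum (map (toℕ ∘ p) xs)
  countB≡sum p []       = refl
  countB≡sum p (x ∷ xs) = trans (countB-∷ p x xs) (cong (λ n → toℕ (p x) + n) (countB≡sum p xs))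

  countB-cong : ∀ {p q : A → Bool} xs → (∀ x → p x ≡ q x) → countB p xs ≡ countB q xs
  countB-cong []       _   = refl
  countB-cong {p} {q} (x ∷ xs) p≗q = begin
    countB p (x ∷ xs)           ≡⟨ countB-∷ p x xs ⟩
    toℕ (p x) + countB p xs     ≡⟨ cong₂ _+_ (cong toℕ (p≗q x)) (countB-cong xs p≗q) ⟩
    toℕ (q x) + countB q xs     ≡⟨ countB-∷ q x xs ⟨
    countB q (x ∷ xs)           ∎
    where open ≡-Reasoning

  countB-none : ∀ {p : A → Bool} xs → (∀ x → p x ≡ false) → countB p xs ≡ 0
  countB-none []       _  = refl
  countB-none (x ∷ xs) p≗false rewrite p≗false x = countB-none xs p≗false

  countB-all : ∀ (xs : List A) → countB (λ _ → true) xs ≡ length xs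
  countB-all []       = refl
  countB-all (_ ∷ xs) = cong suc (countB-all xs)

  countB-∧ˡ : ∀ c (p : A → Bool) xs → countB (λ x → c ∧ p x) xs ≡ toℕ c * countB p xs
  countB-∧ˡ true  p xs = sym (+-identityʳ (countB p xs))
  countB-∧ˡ false p xs = countB-none xs (λ _ → refl)

  sum-cong : ∀ {f g : A → ℕ} xs → (∀ x → f x ≡ g x) → sum (map f xs) ≡ sum (map g xs)
  sum-cong []       _   = refl
  sum-cong (x ∷ xs) f≗g = cong₂ _+_ (f≗g x) (sum-cong xs f≗g)

  sum-map-+ : ∀ (f g : A → ℕ) xs →
              sum (map (λ x → f x + g x) xs) ≡ sum (map f xs) + sum (map g xs)
  sum-map-+ f g []       = refl
  sum-map-+ f g (x ∷ xs) =
    trans (cong (λ n → (f x + g x) + n) (sum-map-+ f g xs))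
          (+-interchange (f x) (g x) (sum (map f xs)) (sum (map g xs)))

  sum-map-* : ∀ c (f : A → ℕ) xs → sum (map (λ x → c * f x) xs) ≡ c * sum (map f xs)
  sum-map-* c f []       = sym (*-zeroʳ c)
  sum-map-* c f (x ∷ xs) = trans (cong (λ n → c * f x + n) (sum-map-* c f xs))
                                 (sym (*-distribˡ-+ c (f x) (sum (map f xs))))

  countB-split : ∀ {p q r : A → Bool} xs →
                 (∀ x → toℕ (p x) ≡ toℕ (q x) + toℕ (r x)) →
                 countB p xs ≡ countB q xs + countB r xs
  countB-split {p} {q} {r} xs p≗q+r = begin
    countB p xs                                       ≡⟨ countB≡sum p xs ⟩
    sum (map (toℕ ∘ p) xs)                            ≡⟨ sum-cong xs p≗q+r ⟩
    sum (map (λ x → toℕ (q x) + toℕ (r x)) xs)        ≡⟨ sum-map-+ (toℕ ∘ q) (toℕ ∘ r) xs ⟩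
    sum (map (toℕ ∘ q) xs) + sum (map (toℕ ∘ r) xs)   ≡⟨ cong₂ _+_ (countB≡sum q xs) (countB≡sum r xs) ⟨
    countB q xs + countB r xs                         ∎
    where open ≡-Reasoning

  any-witness : ∀ (p : A → Bool) xs → any p xs ≡ true → Σ A (λ x → p x ≡ true)
  any-witness p (x ∷ xs) any≡true with p x in px≡true
  ... | true  = x , px≡true
  ... | false = any-witness p xs any≡true

  any-intro : ∀ (p q : A → Bool) xs {n} → (∀ x → p x ≡ true → q x ≡ true) →
              countB p xs ≡ suc n → any q xs ≡ true
  any-intro p q (x ∷ xs) p⇒q count≡suc with p x in px≡true
  ... | true rewrite p⇒q x px≡true = refl
  ... | false with q x
  ...   | true  = refl
  ...   | false = any-intro p q xs p⇒q count≡suc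

module _ {A B : Set} where

  sum-countB-swap : ∀ (r : A → B → Bool) xs ys →
    sum (map (λ x → countB (r x) ys) xs) ≡ sum (map (λ y → countB (λ x → r x y) xs) ys)
  sum-countB-swap r []       ys = sym (sum-none ys)
    where
    sum-none : ∀ (ys : List B) → sum (map (λ _ → 0) ys) ≡ 0
    sum-none []       = refl
    sum-none (_ ∷ ys) = sum-none ys
  sum-countB-swap r (x ∷ xs) ys = begin
    countB (r x) ys + sum (map (λ x → countB (r x) ys) xs)
      ≡⟨ cong₂ _+_ (countB≡sum (r x) ys) (sum-countB-swap r xs ys) ⟩
    sum (map (toℕ ∘ r x) ys) + sum (map (λ y → countB (λ x → r x y) xs) ys)
      ≡⟨ sum-map-+ (toℕ ∘ r x) (λ y → countB (λ x → r x y) xs) ys ⟨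
    sum (map (λ y → toℕ (r x y) + countB (λ x → r x y) xs) ys)
      ≡⟨ sum-cong ys (λ y → countB-∷ (λ x → r x y) x xs) ⟨
    sum (map (λ y → countB (λ x → r x y) (x ∷ xs)) ys)
      ∎
    where open ≡-Reasoning

  countB-by-blocks : ∀ (p : A → Bool) (r : A → B → Bool) xs ys →
    (∀ x → countB (r x) ys ≡ 1) →
    countB p xs ≡ sum (map (λ y → countB (λ x → p x ∧ r x y) xs) ys)
  countB-by-blocks p r xs ys r-unique = begin
    countB p xs                                               ≡⟨ countB≡sum p xs ⟩
    sum (map (toℕ ∘ p) xs)                                    ≡⟨ sum-cong xs in-one-block ⟩
    sum (map (λ x → countB (λ y → p x ∧ r x y) ys) xs)        ≡⟨ sum-countB-swap (λ x y → p x ∧ r x y) xs ys ⟩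
    sum (map (λ y → countB (λ x → p x ∧ r x y) xs) ys)        ∎
    where
    open ≡-Reasoning
    in-one-block : ∀ x → toℕ (p x) ≡ countB (λ y → p x ∧ r x y) ys
    in-one-block x = sym (trans (countB-∧ˡ (p x) (r x) ys)
                                (trans (cong (toℕ (p x) *_) (r-unique x)) (*-identityʳ (toℕ (p x)))))

n+[b]≡m⇒+n≡+m-1 : ∀ {n m b} → b ≡ true → n + toℕ b ≡ m → + n ≡ + m - + 1
n+[b]≡m⇒+n≡+m-1 {n} refl refl = cong (λ k → + k - + 1) (+-comm 1 n)

n+[b]≡m⇒+n≡+m : ∀ {n m b} → b ≡ false → n + toℕ b ≡ m → + n ≡ + m
n+[b]≡m⇒+n≡+m {n} refl refl = cong +_ (sym (+-identityʳ n))

module FinGroupCounting (X : FinGroup) where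
  open FinGroup X renaming (refl to ≈-refl; sym to ≈-sym; trans to ≈-trans)
  open GroupProperties group using (\\-leftDividesˡ; \\-leftDividesʳ; //-rightDividesˡ;
                                   ⁻¹-involutive; ⁻¹-anti-homo-∙)

  IsSumSet⇒reps≡ : ∀ {w k μ T} → IsSumSet X w k μ T → ∀ a → ¬ (a ≈ ε) → + reps X T a ≡ μ
  IsSumSet⇒reps≡ {T = T} (_ , _ , reps-in , reps-out) a a≉ε with T a in a∈T
  ... | true  = reps-in a a≉ε a∈T
  ... | false = reps-out a a≉ε a∈T

  countB-∧-≟ : ∀ c b → countB (λ y → c ∧ ⌊ b ≟ y ⌋) elems ≡ toℕ c
  countB-∧-≟ c b =
    trans (countB-∧ˡ c (λ y → ⌊ b ≟ y ⌋) elems)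
          (trans (cong (toℕ c *_) (complete b)) (*-identityʳ (toℕ c)))

  countB-∘-bijection : ∀ (p : Subset X) → Respects X p → (f g : Carrier → Carrier) →
    (∀ {x y} → x ≈ y → f x ≈ f y) → (∀ {x y} → x ≈ y → g x ≈ g y) →
    (∀ y → f (g y) ≈ y) → (∀ x → g (f x) ≈ x) →
    countB (p ∘ f) elems ≡ countB p elems
  countB-∘-bijection p p-resp f g f-cong g-cong fg≈id gf≈id = begin
    countB (p ∘ f) elems
      ≡⟨ countB-by-blocks (p ∘ f) (λ x y → ⌊ f x ≟ y ⌋) elems elems (complete ∘ f) ⟩
    sum (map (λ y → countB (λ x → p (f x) ∧ ⌊ f x ≟ y ⌋) elems) elems)
      ≡⟨ sum-cong elems (λ y → countB-cong elems (block y)) ⟩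
    sum (map (λ y → countB (λ x → p y ∧ ⌊ g y ≟ x ⌋) elems) elems)
      ≡⟨ sum-cong elems (λ y → countB-∧-≟ (p y) (g y)) ⟩
    sum (map (toℕ ∘ p) elems)
      ≡⟨ countB≡sum p elems ⟨
    countB p elems
      ∎
    where
    open ≡-Reasoning
    block : ∀ y x → (p (f x) ∧ ⌊ f x ≟ y ⌋) ≡ (p y ∧ ⌊ g y ≟ x ⌋)
    block y x with f x ≟ y | g y ≟ x
    ... | yes fx≈y | yes _     = cong (_∧ true) (p-resp fx≈y)
    ... | yes fx≈y | no gy≉x   = contradiction (≈-trans (g-cong (≈-sym fx≈y)) (gf≈id x)) gy≉x
    ... | no fx≉y  | yes gy≈x  = contradiction (≈-trans (f-cong (≈-sym gy≈x)) (fg≈id y)) fx≉y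
    ... | no _     | no _      = trans (∧-zeroʳ _) (sym (∧-zeroʳ _))

  countB-∘-⁻¹∙ : ∀ (p : Subset X) → Respects X p → ∀ a →
                 countB (λ x → p (x ⁻¹ ∙ a)) elems ≡ countB p elems
  countB-∘-⁻¹∙ p p-resp a =
    countB-∘-bijection p p-resp (λ x → x ⁻¹ ∙ a) (λ y → a ∙ y ⁻¹)
      (λ x≈y → ∙-congʳ (⁻¹-cong x≈y)) (λ x≈y → ∙-congˡ (⁻¹-cong x≈y))
      (λ y → ≈-trans (∙-congʳ (⁻¹-anti-homo-∙ a (y ⁻¹)))
                     (≈-trans (//-rightDividesˡ a (y ⁻¹ ⁻¹)) (⁻¹-involutive y)))
      (λ x → ≈-trans (∙-congˡ (⁻¹-anti-homo-∙ (x ⁻¹) a))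
                     (≈-trans (\\-leftDividesˡ a (x ⁻¹ ⁻¹)) (⁻¹-involutive x)))

  reps≡countB : ∀ (T : Subset X) → Respects X T → ∀ a →
                reps X T a ≡ countB (λ x → T x ∧ T (x ⁻¹ ∙ a)) elems
  reps≡countB T T-resp a = begin
    reps X T a
      ≡⟨ sum-cong elems (λ x → countB-cong elems (solution x)) ⟩
    sum (map (λ x → countB (λ y → (T x ∧ T (x ⁻¹ ∙ a)) ∧ ⌊ (x ⁻¹ ∙ a) ≟ y ⌋) elems) elems)
      ≡⟨ sum-cong elems (λ x → countB-∧-≟ (T x ∧ T (x ⁻¹ ∙ a)) (x ⁻¹ ∙ a)) ⟩
    sum (map (λ x → toℕ (T x ∧ T (x ⁻¹ ∙ a))) elems)
      ≡⟨ countB≡sum (λ x → T x ∧ T (x ⁻¹ ∙ a)) elems ⟨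
    countB (λ x → T x ∧ T (x ⁻¹ ∙ a)) elems
      ∎
    where
    open ≡-Reasoning
    solution : ∀ x y → (T x ∧ T y ∧ ⌊ (x ∙ y) ≟ a ⌋) ≡ ((T x ∧ T (x ⁻¹ ∙ a)) ∧ ⌊ (x ⁻¹ ∙ a) ≟ y ⌋)
    solution x y with (x ∙ y) ≟ a | (x ⁻¹ ∙ a) ≟ y
    ... | yes _      | yes x⁻¹a≈y =
      trans (cong (λ b → T x ∧ b ∧ true) (T-resp (≈-sym x⁻¹a≈y))) (sym (∧-assoc (T x) _ true))
    ... | yes xy≈a   | no x⁻¹a≉y  =
      contradiction (≈-trans (∙-congˡ (≈-sym xy≈a)) (\\-leftDividesʳ x y)) x⁻¹a≉y
    ... | no xy≉a    | yes x⁻¹a≈y =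
      contradiction (≈-trans (∙-congˡ (≈-sym x⁻¹a≈y)) (\\-leftDividesˡ x a)) xy≉a
    ... | no _       | no _       =
      trans (cong (T x ∧_) (∧-zeroʳ (T y))) (trans (∧-zeroʳ (T x)) (sym (∧-zeroʳ _)))

module CosetCounting (G : FinGroup) (z : FinGroup.Carrier G) (hN : NormalOrder2 G z) where
  open FinGroup G renaming (refl to ≈-refl; sym to ≈-sym; trans to ≈-trans)
  open NormalOrder2 hN
  open Quotient G z hN
  open FinGroupCounting G
  open GroupProperties group using (\\-leftDividesˡ; \\-leftDividesʳ; ε⁻¹≈ε)
  module ∼-Reasoning = SetoidReasoning (Group.setoid quotientGroup)

  N : Subset G
  N = pairN G z

  ∼-refl : ∀ {x} → x ∼ x
  ∼-refl = inj₁ ≈-refl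

  ≈⇒∼ : ∀ {x y} → x ≈ y → x ∼ y
  ≈⇒∼ x≈y = inj₁ (≈-sym x≈y)

  N⇒ε∼ : ∀ {x} → N x ≡ true → ε ∼ x
  N⇒ε∼ {x} x∈N with fromPairN x x∈N
  ... | inj₁ x≈ε = inj₁ x≈ε
  ... | inj₂ x≈z = inj₂ (≈-trans x≈z (≈-sym (identityˡ z)))

  ≉⇒≁ : ∀ {x w} → ¬ (x ≈ w) → ¬ (x ∙ z ≈ w) → ¬ (x ∼ w)
  ≉⇒≁ x≉w _    (inj₁ w≈x)  = x≉w (≈-sym w≈x)
  ≉⇒≁ _   xz≉w (inj₂ w≈xz) = xz≉w (≈-sym w≈xz)

  ε∼⇒N : ∀ {x} → ε ∼ x → N x ≡ true
  ε∼⇒N {x} ε∼x with x ≟ ε | x ≟ z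
  ... | yes _   | _       = refl
  ... | no _    | yes _   = refl
  ... | no x≉ε  | no x≉z  =
    contradiction ε∼x (≉⇒≁ (x≉ε ∘ ≈-sym) (λ εz≈x → x≉z (≈-trans (≈-sym εz≈x) (identityˡ z))))

  N-resp : Respects G N
  N-resp x≈y = true-ext (λ x∈N → ε∼⇒N (∼-trans (N⇒ε∼ x∈N) (≈⇒∼ x≈y)))
                        (λ y∈N → ε∼⇒N (∼-trans (N⇒ε∼ y∈N) (≈⇒∼ (≈-sym x≈y))))

  N-⁻¹∙⇒∼ : ∀ {x w} → N (x ⁻¹ ∙ w) ≡ true → x ∼ w
  N-⁻¹∙⇒∼ {x} {w} x⁻¹w∈N = begin
    x               ≈⟨ ≈⇒∼ (≈-sym (identityʳ x)) ⟩
    x ∙ ε           ≈⟨ ∼-∙-cong ∼-refl (N⇒ε∼ x⁻¹w∈N) ⟩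
    x ∙ (x ⁻¹ ∙ w)  ≈⟨ ≈⇒∼ (\\-leftDividesˡ x w) ⟩
    w               ∎
    where open ∼-Reasoning

  ∼⇒N-⁻¹∙ : ∀ {x w} → x ∼ w → N (x ⁻¹ ∙ w) ≡ true
  ∼⇒N-⁻¹∙ {x} {w} x∼w = ε∼⇒N (begin
    ε         ≈⟨ ≈⇒∼ (≈-sym (inverseˡ x)) ⟩
    x ⁻¹ ∙ x  ≈⟨ ∼-∙-cong ∼-refl x∼w ⟩
    x ⁻¹ ∙ w  ∎)
    where open ∼-Reasoning

  N⇒∼⁻¹∙ : ∀ {x} a → N x ≡ true → a ∼ x ⁻¹ ∙ a
  N⇒∼⁻¹∙ {x} a x∈N = begin
    a          ≈⟨ ≈⇒∼ (≈-sym (≈-trans (∙-congʳ ε⁻¹≈ε) (identityˡ a))) ⟩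
    ε ⁻¹ ∙ a   ≈⟨ ∼-∙-cong (∼-⁻¹-cong (N⇒ε∼ x∈N)) ∼-refl ⟩
    x ⁻¹ ∙ a   ∎
    where open ∼-Reasoning

  x≉x∙z : ∀ x → ¬ (x ≈ x ∙ z)
  x≉x∙z x x≈xz = z≉ε (≈-trans (≈-sym (\\-leftDividesʳ x z))
                             (≈-trans (∙-congˡ (≈-sym x≈xz)) (inverseˡ x)))

  countB-coset : ∀ (q : Subset G) → Respects G q → ∀ x →
    countB (λ w → q w ∧ N (x ⁻¹ ∙ w)) elems ≡ toℕ (q x) + toℕ (q (x ∙ z))
  countB-coset q q-resp x =
    trans (countB-split elems split)
          (cong₂ _+_ (countB-∧-≟ (q x) x) (countB-∧-≟ (q (x ∙ z)) (x ∙ z)))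
    where
    split : ∀ w → toℕ (q w ∧ N (x ⁻¹ ∙ w)) ≡
                  toℕ (q x ∧ ⌊ x ≟ w ⌋) + toℕ (q (x ∙ z) ∧ ⌊ (x ∙ z) ≟ w ⌋)
    split w with x ≟ w | (x ∙ z) ≟ w
    ... | yes x≈w | yes xz≈w = contradiction (≈-trans x≈w (≈-sym xz≈w)) (x≉x∙z x)
    ... | yes x≈w | no _
      rewrite ∼⇒N-⁻¹∙ (≈⇒∼ x≈w) | q-resp x≈w | ∧-zeroʳ (q (x ∙ z)) = sym (+-identityʳ _)
    ... | no _    | yes xz≈w
      rewrite ∼⇒N-⁻¹∙ {x} {w} (inj₂ (≈-sym xz≈w)) | q-resp xz≈w | ∧-zeroʳ (q x) = refl
    ... | no x≉w  | no xz≉w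
      rewrite ¬-not (≉⇒≁ x≉w xz≉w ∘ N-⁻¹∙⇒∼) | ∧-zeroʳ (q w) | ∧-zeroʳ (q x)
            | ∧-zeroʳ (q (x ∙ z)) = refl

  module _ (R : List Carrier) (hR : ∀ x → countB (λ y → ⌊ x ∼? y ⌋) R ≡ 1) where

    countB-elems≡2*countB-transversal : ∀ (h : Subset G) → Respects (quotientFin R hR) h →
      countB h elems ≡ 2 * countB h R
    countB-elems≡2*countB-transversal h h-resp = begin
      countB h elems
        ≡⟨ countB-by-blocks h (λ x y → ⌊ x ∼? y ⌋) elems R hR ⟩
      sum (map (λ y → countB (λ x → h x ∧ ⌊ x ∼? y ⌋) elems) R)
        ≡⟨ sum-cong R (λ y → countB-cong elems (block y)) ⟩
      sum (map (λ y → countB (λ x → h y ∧ N (y ⁻¹ ∙ x)) elems) R)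
        ≡⟨ sum-cong R (λ y → trans (countB-coset (λ _ → h y) (λ _ → refl) y) (toℕ-double (h y))) ⟩
      sum (map (λ y → 2 * toℕ (h y)) R)
        ≡⟨ sum-map-* 2 (toℕ ∘ h) R ⟩
      2 * sum (map (toℕ ∘ h) R)
        ≡⟨ cong (2 *_) (countB≡sum h R) ⟨
      2 * countB h R
        ∎
      where
      open ≡-Reasoning
      block : ∀ y x → (h x ∧ ⌊ x ∼? y ⌋) ≡ (h y ∧ N (y ⁻¹ ∙ x))
      block y x with x ∼? y
      ... | yes x∼y = cong₂ _∧_ (h-resp x∼y) (sym (∼⇒N-⁻¹∙ (∼-sym x∼y)))
      ... | no x≁y  = trans (∧-zeroʳ (h x))
                            (sym (trans (cong (h y ∧_) (¬-not (x≁y ∘ ∼-sym ∘ N-⁻¹∙⇒∼)))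
                                        (∧-zeroʳ (h y))))

module TypeTwo (G : FinGroup) (z : FinGroup.Carrier G) (hN : NormalOrder2 G z)
               (S : Subset G) (S-resp : Respects G S) (type2 : IsType2 G (pairN G z) S) where
  open FinGroup G renaming (refl to ≈-refl; sym to ≈-sym; trans to ≈-trans)
  open Quotient G z hN
  open FinGroupCounting G
  open CosetCounting G z hN

  S∖N : Subset G
  S∖N x = S x ∧ not (N x)

  S∩N : Subset G
  S∩N x = S x ∧ N x

  S∖N-resp : Respects G S∖N
  S∖N-resp x≈y = cong₂ (λ s n → s ∧ not n) (S-resp x≈y) (N-resp x≈y)

  S∩N-resp : Respects G S∩N
  S∩N-resp x≈y = cong₂ _∧_ (S-resp x≈y) (N-resp x≈y)

  S∩N⇒N : ∀ {x} → S∩N x ≡ true → N x ≡ true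
  S∩N⇒N {x} = ∧-conicalʳ (S x) (N x)

  S∖N-∙z : ∀ {x} → S∖N x ≡ true → S∖N (x ∙ z) ≡ true
  S∖N-∙z {x} x∈S∖N = cong₂ (λ s n → s ∧ not n) xz∈S xz∉N
    where
    x∈S : S x ≡ true
    x∈S = ∧-conicalˡ (S x) _ x∈S∖N
    x∉N : N x ≡ false
    x∉N = not-injective (∧-conicalʳ (S x) _ x∈S∖N)
    coset-count : countB (λ w → S w ∧ N (x ⁻¹ ∙ w)) elems ≡ 1 + toℕ (S (x ∙ z))
    coset-count = trans (countB-coset S S-resp x) (cong (λ b → toℕ b + toℕ (S (x ∙ z))) x∈S)
    -- the coset xN already meets S in x, so by type 2 it meets S in x ∙ z too
    xz∈S : S (x ∙ z) ≡ true
    xz∈S with S (x ∙ z) | coset-count | proj₂ type2 x x∉N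
    ... | true  | _       | _            = refl
    ... | false | count≡1 | inj₁ count≡0 = contradiction (trans (sym count≡0) count≡1) λ ()
    ... | false | count≡1 | inj₂ count≡2 = contradiction (trans (sym count≡2) count≡1) λ ()
    xz∉N : N (x ∙ z) ≡ false
    xz∉N = ¬-not λ xz∈N →
      contradiction (trans (sym x∉N) (ε∼⇒N (∼-trans (N⇒ε∼ xz∈N) (inj₂ (≈-sym (xzz x)))))) λ ()

  S∖N-resp-∼ : ∀ {x y} → x ∼ y → S∖N x ≡ S∖N y
  S∖N-resp-∼     (inj₁ y≈x)  = S∖N-resp (≈-sym y≈x)
  S∖N-resp-∼ {x} (inj₂ y≈xz) = trans x∈S∖N⇔xz∈S∖N (S∖N-resp (≈-sym y≈xz))
    where
    x∈S∖N⇔xz∈S∖N : S∖N x ≡ S∖N (x ∙ z)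
    x∈S∖N⇔xz∈S∖N = true-ext S∖N-∙z (λ xz∈S∖N → trans (sym (S∖N-resp (xzz x))) (S∖N-∙z xz∈S∖N))

  cosetImage≡S∖N : ∀ c → cosetImage S c ≡ S∖N c
  cosetImage≡S∖N c = true-ext image⇒S∖N S∖N⇒image
    where
    image⇒S∖N : cosetImage S c ≡ true → S∖N c ≡ true
    image⇒S∖N c∈P with any-witness _ elems c∈P
    ... | s , s∈S∖N∧c∼s = trans (S∖N-resp-∼ (true⇒witness (c ∼? s) (∧-conicalʳ _ _ witness)))
                                (∧-conicalˡ _ _ witness)
      where
      witness : (S∖N s ∧ ⌊ c ∼? s ⌋) ≡ true
      witness = trans (∧-assoc (S s) _ _) s∈S∖N∧c∼s
    S∖N⇒image : S∖N c ≡ true → cosetImage S c ≡ true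
    S∖N⇒image c∈S∖N = any-intro (λ y → ⌊ c ≟ y ⌋) _ elems
      (λ y c≟y → image-witness y (true⇒witness (c ≟ y) c≟y))
      (complete c)
      where
      image-witness : ∀ y → c ≈ y → (S y ∧ not (N y) ∧ ⌊ c ∼? y ⌋) ≡ true
      image-witness y c≈y = trans (sym (∧-assoc (S y) _ _))
        (cong₂ _∧_ (trans (sym (S∖N-resp c≈y)) c∈S∖N) (witness⇒true (c ∼? y) (≈⇒∼ c≈y)))

  size≡size-S∖N+1 : size G S ≡ countB S∖N elems + 1
  size≡size-S∖N+1 =
    trans (countB-split elems (λ x → toℕ-partition (S x) (N x)))
          (cong (λ n → countB S∖N elems + n) (proj₁ type2))

  countB-S∖N-S∩N : ∀ a → countB (λ x → S∖N x ∧ S∩N (x ⁻¹ ∙ a)) elems ≡ toℕ (S∖N a)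
  countB-S∖N-S∩N a = begin
    countB (λ x → S∖N x ∧ S∩N (x ⁻¹ ∙ a)) elems
      ≡⟨ countB-cong elems (λ x → ∧-congˡ-guarded (S∖N-resp-∼ ∘ N-⁻¹∙⇒∼ ∘ S∩N⇒N)) ⟩
    countB (λ x → S∖N a ∧ S∩N (x ⁻¹ ∙ a)) elems
      ≡⟨ countB-∧ˡ (S∖N a) (λ x → S∩N (x ⁻¹ ∙ a)) elems ⟩
    toℕ (S∖N a) * countB (λ x → S∩N (x ⁻¹ ∙ a)) elems
      ≡⟨ cong (toℕ (S∖N a) *_) (trans (countB-∘-⁻¹∙ S∩N S∩N-resp a) (proj₁ type2)) ⟩
    toℕ (S∖N a) * 1
      ≡⟨ *-identityʳ (toℕ (S∖N a)) ⟩
    toℕ (S∖N a)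
      ∎
    where open ≡-Reasoning

  countB-S∩N-S∖N : ∀ a → countB (λ x → S∩N x ∧ S∖N (x ⁻¹ ∙ a)) elems ≡ toℕ (S∖N a)
  countB-S∩N-S∖N a = begin
    countB (λ x → S∩N x ∧ S∖N (x ⁻¹ ∙ a)) elems
      ≡⟨ countB-cong elems (λ x → trans (∧-congʳ-guarded (sym ∘ S∖N-resp-∼ ∘ N⇒∼⁻¹∙ a ∘ S∩N⇒N))
                                         (∧-comm (S∩N x) (S∖N a))) ⟩
    countB (λ x → S∖N a ∧ S∩N x) elems
      ≡⟨ countB-∧ˡ (S∖N a) S∩N elems ⟩
    toℕ (S∖N a) * countB S∩N elems
      ≡⟨ cong (toℕ (S∖N a) *_) (proj₁ type2) ⟩
    toℕ (S∖N a) * 1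
      ≡⟨ *-identityʳ (toℕ (S∖N a)) ⟩
    toℕ (S∖N a)
      ∎
    where open ≡-Reasoning

  countB-S∩N-S∩N : ∀ a → ¬ (a ∼ ε) → countB (λ x → S∩N x ∧ S∩N (x ⁻¹ ∙ a)) elems ≡ 0
  countB-S∩N-S∩N a a≁ε = countB-none elems λ x → ¬-not λ both →
    a≁ε (∼-sym (∼-trans (N⇒ε∼ (S∩N⇒N (∧-conicalˡ (S∩N x) _ both)))
                        (N-⁻¹∙⇒∼ (S∩N⇒N (∧-conicalʳ (S∩N x) _ both)))))

  reps≡countB-S∖N : ∀ a → ¬ (a ∼ ε) →
    reps G S a ≡ countB (λ x → S∖N x ∧ S∖N (x ⁻¹ ∙ a)) elems + 2 * toℕ (S∖N a)
  reps≡countB-S∖N a a≁ε = begin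
    reps G S a
      ≡⟨ reps≡countB S S-resp a ⟩
    countB (λ x → S x ∧ S (x ⁻¹ ∙ a)) elems
      ≡⟨ countB-split elems (λ x → toℕ-partitionˡ (S x) (N x) (S (x ⁻¹ ∙ a))) ⟩
    countB (λ x → S∖N x ∧ S (x ⁻¹ ∙ a)) elems + countB (λ x → S∩N x ∧ S (x ⁻¹ ∙ a)) elems
      ≡⟨ cong₂ _+_ (countB-split elems (λ x → toℕ-partitionʳ (S∖N x) (S (x ⁻¹ ∙ a)) (N (x ⁻¹ ∙ a))))
                   (countB-split elems (λ x → toℕ-partitionʳ (S∩N x) (S (x ⁻¹ ∙ a)) (N (x ⁻¹ ∙ a)))) ⟩
    (both∈S∖N + countB (λ x → S∖N x ∧ S∩N (x ⁻¹ ∙ a)) elems)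
      + (countB (λ x → S∩N x ∧ S∖N (x ⁻¹ ∙ a)) elems + countB (λ x → S∩N x ∧ S∩N (x ⁻¹ ∙ a)) elems)
      ≡⟨ cong₂ _+_ (cong (λ n → both∈S∖N + n) (countB-S∖N-S∩N a))
                   (cong₂ _+_ (countB-S∩N-S∖N a) (countB-S∩N-S∩N a a≁ε)) ⟩
    (both∈S∖N + toℕ (S∖N a)) + (toℕ (S∖N a) + 0)
      ≡⟨ +-assoc both∈S∖N (toℕ (S∖N a)) (toℕ (S∖N a) + 0) ⟩  -- 2 * t unfolds to t + (t + 0)
    both∈S∖N + 2 * toℕ (S∖N a)
      ∎
    where
    open ≡-Reasoning
    both∈S∖N = countB (λ x → S∖N x ∧ S∖N (x ⁻¹ ∙ a)) elems

  module _ (R : List Carrier) (hR : ∀ x → countB (λ y → ⌊ x ∼? y ⌋) R ≡ 1) where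

    G/N : FinGroup
    G/N = quotientFin R hR

    cosetImage-resp : Respects G/N (cosetImage S)
    cosetImage-resp {x} {y} x∼y =
      trans (cosetImage≡S∖N x) (trans (S∖N-resp-∼ x∼y) (sym (cosetImage≡S∖N y)))

    2*order-quotient≡order : 2 * order G/N ≡ order G
    2*order-quotient≡order = begin
      2 * length R                   ≡⟨ cong (2 *_) (countB-all R) ⟨
      2 * countB (λ _ → true) R      ≡⟨ countB-elems≡2*countB-transversal R hR (λ _ → true) (λ _ → refl) ⟨
      countB (λ _ → true) elems      ≡⟨ countB-all elems ⟩
      length elems                   ∎
      where open ≡-Reasoning

    2*size-image+1≡size : 2 * size G/N (cosetImage S) + 1 ≡ size G S
    2*size-image+1≡size = begin
      2 * countB (cosetImage S) R + 1  ≡⟨ cong (λ n → 2 * n + 1) (countB-cong R cosetImage≡S∖N) ⟩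
      2 * countB S∖N R + 1             ≡⟨ cong (_+ 1) (countB-elems≡2*countB-transversal R hR S∖N S∖N-resp-∼) ⟨
      countB S∖N elems + 1             ≡⟨ size≡size-S∖N+1 ⟨
      size G S                         ∎
      where open ≡-Reasoning

    2*[reps-image+image]≡reps : ∀ a → ¬ (a ∼ ε) →
      2 * (reps G/N (cosetImage S) a + toℕ (cosetImage S a)) ≡ reps G S a
    2*[reps-image+image]≡reps a a≁ε = begin
      2 * (reps G/N (cosetImage S) a + toℕ (cosetImage S a))
        ≡⟨ *-distribˡ-+ 2 (reps G/N (cosetImage S) a) (toℕ (cosetImage S a)) ⟩
      2 * reps G/N (cosetImage S) a + 2 * toℕ (cosetImage S a)
        ≡⟨ cong₂ (λ r b → 2 * r + 2 * toℕ b) reps-image≡countB (cosetImage≡S∖N a) ⟩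
      2 * countB S∖N-pairs R + 2 * toℕ (S∖N a)
        ≡⟨ cong (_+ 2 * toℕ (S∖N a)) (countB-elems≡2*countB-transversal R hR S∖N-pairs S∖N-pairs-resp) ⟨
      countB S∖N-pairs elems + 2 * toℕ (S∖N a)
        ≡⟨ reps≡countB-S∖N a a≁ε ⟨
      reps G S a
        ∎
      where
      open ≡-Reasoning
      S∖N-pairs : Subset G
      S∖N-pairs x = S∖N x ∧ S∖N (x ⁻¹ ∙ a)
      S∖N-pairs-resp : Respects G/N S∖N-pairs
      S∖N-pairs-resp x∼y = cong₂ _∧_ (S∖N-resp-∼ x∼y) (S∖N-resp-∼ (∼-∙-cong (∼-⁻¹-cong x∼y) ∼-refl))
      reps-image≡countB : reps G/N (cosetImage S) a ≡ countB S∖N-pairs R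
      reps-image≡countB =
        trans (FinGroupCounting.reps≡countB G/N (cosetImage S) cosetImage-resp a)
              (countB-cong R (λ x → cong₂ _∧_ (cosetImage≡S∖N x) (cosetImage≡S∖N (x ⁻¹ ∙ a))))

    reps-image+[∈image]≡β : ∀ {w k β} → IsSumSet G w k (+ (2 * β)) S → ∀ a → ¬ (a ∼ ε) →
      reps G/N (cosetImage S) a + toℕ (cosetImage S a) ≡ β
    reps-image+[∈image]≡β sumSet a a≁ε = *-cancelˡ-≡ _ _ 2
      (trans (2*[reps-image+image]≡reps a a≁ε) (ℤ.+-injective (IsSumSet⇒reps≡ sumSet a (a≁ε ∘ ≈⇒∼))))

theorem5p4 : (G : FinGroup) (v k β : ℕ) (z : FinGroup.Carrier G)
    → (hN : NormalOrder2 G z)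
    → order G ≡ 2 * v
    → (S : Subset G) → Respects G S
    → IsSumSet G (2 * v) (2 * k + 1) (+ (2 * β)) S
    → IsType2 G (pairN G z) S
    → (R : List (FinGroup.Carrier G))
    → (hR : ∀ x → countB (λ y → ⌊ Quotient._∼?_ G z hN x y ⌋) R ≡ 1)
    → IsPartialSumSet (Quotient.quotientFin G z hN R hR) v k (+ β - + 1) (+ β)
        (Quotient.cosetImage G z hN S)
theorem5p4 G v k β z hN order≡2v S S-resp sumSet type2 R hR =
    *-cancelˡ-≡ _ v 2 (trans (2*order-quotient≡order R hR) order≡2v)
  , *-cancelˡ-≡ _ k 2 (+-cancelʳ-≡ 1 _ _ (trans (2*size-image+1≡size R hR) (proj₁ (proj₂ sumSet))))
  , (λ a a≁ε a∈P → n+[b]≡m⇒+n≡+m-1 a∈P (reps-image+[∈image]≡β R hR {β = β} sumSet a a≁ε))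
  , (λ a a≁ε a∉P → n+[b]≡m⇒+n≡+m a∉P (reps-image+[∈image]≡β R hR {β = β} sumSet a a≁ε))
  where open TypeTwo G z hN S S-resp type2
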